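{- Let $\mathcal F$ be a Fano plane, $\mathbb F$ a field of characteristic not $2$, and $P\mapsto\alpha_P$ an oriented map, with associated multiplication factors $e^\alpha$ and $-e^\alpha$. Then: (i) $(\mathbb O_{\mathcal F},\mathbf 1,e^\alpha)$ is a composition algebra and it belongs to $\mathbb O_{\mathcal F}{}^+_1$ (the future of every point with respect to $e^\alpha$ is a line); (ii) $(\mathbb O_{\mathcal F},\mathbf 1,-e^\alpha)$ is a composition algebra and it belongs to $\mathbb O_{\mathcal F}{}^-_1$ (the past of every point with respect to $-e^\alpha$ is a line).
   Context: A Fano plane is a set $\mathcal F$ of seven points together with a set of seven $3$-element subsets of $\mathcal F$ called lines, such that any two distinct points lie in a unique line and any two distinct lines meet in a unique point. The Fano cube is $V_{\mathcal F}=\mathcal F\cup\{0\}$ with the unique $\mathbb Z_2$-vector space structure with zero $0$ such that for distinct $P,Q\in\mathcal F$, $P+Q$ is the third point of the line through $P$ and $Q$; $V_{\mathcal F}^\ast$ is its dual. An oriented map is a map $\alpha:\mathcal F\to V_{\mathcal F}^\ast$, $P\mapsto\alpha_P$, with $\alpha_P(P)=1$ for all $P$ and $\alpha_P(Q)+\alpha_Q(P)=1$ for $P\ne Q$. A multiplication factor is a map $\epsilon:\{(P,Q)\in\mathcal F^2:P\ne Q\}\to\{ -1,1\}$ with $\epsilon_{QP}=-\epsilon_{PQ}$; the future of $P$ is $\overrightarrow{P}=\{Q\ne P:\epsilon_{PQ}=1\}$ and the past is $\overleftarrow{P}=\{Q\ne P:\epsilon_{PQ}=-1\}$. The multiplication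 factors associated to $\alpha$ are $e^\alpha_{PQ}=(-1)^{\alpha_P(Q)}$ and $(-e^\alpha)_{PQ}=-(-1)^{\alpha_P(Q)}$ for $P\ne Q$. $\mathbb O_{\mathcal F}$ is the $\mathbb F$-vector space of $\mathbb F$-valued functions on $V_{\mathcal F}$, with basis $e_P$ ($P\in V_{\mathcal F}$), $e_P$ the indicator function of $P$. Given $\epsilon$, the multiplication $\cdot_\epsilon$ is bilinear with $e_P\cdot_\epsilon e_Q=\epsilon_{PQ}e_{P+Q}$ for $P\ne Q$ in $\mathcal F$, $e_P\cdot_\epsilon e_P=-e_0$ for $P\in\mathcal F$, and $e_0$ a two-sided unit. $\mathbf 1$ denotes the quadratic form $N_{\mathbb O}(\lambda^0e_0+\sum_P\lambda^Pe_P)=(\lambda^0)^2+\sum_P(\lambda^P)^2$. $(\mathbb O_{\mathcal F},\mathbf 1,\epsilon)$ is a composition algebra iff $N_{\mathbb O}(Z\cdot_\epsilon W)=N_{\mathbb O}(Z)N_{\mathbb O}(W)$ for all $Z,W$. $\mathbb O_{\mathcal F}{}^+_1$ (resp. $\mathbb O_{\mathcal F}{}^-_1$) is the set of composition algebras $(\mathbb O_{\mathcal F},\mathbf 1,\epsilon)$ such that $\overrightarrow{P}$ (resp. $\overleftarrow{P}$) is a line for all $P\in\mathcal F$. -}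

module Defs where

open import Level using (Level; _⊔_)
open import Data.Bool using (Bool; true; false; _∧_; _xor_; not; if_then_else_)
open import Data.Fin using (Fin; zero; suc)
open import Data.Fin.Properties using () renaming (_≟_ to _≟F_)
open import Data.Maybe using (Maybe; nothing; just; maybe′)
open import Data.Nat using (ℕ)
open import Data.List using (List; _∷_; []; map; foldr; filterᵇ; length; allFin)
open import Data.Product using (Σ; _×_; _,_)
open import Data.Sign using (Sign; opposite)
open import Relation.Binary.PropositionalEquality using (_≡_; _≢_)
open import Relation.Nullary using (¬_; does)
open import Algebra.Bundles using (CommutativeRing)

Pt : Set
Pt = Fin 7

points : List Pt
points = allFin 7

Lines : Set
Lines = Fin 7 → Pt → Bool

card : (Pt → Bool) → ℕ
card s = length (filterᵇ s points)

record IsFanoPlane (L : Lines) : Set where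
  field
    three      : ∀ l → card (L l) ≡ 3
    distinct   : ∀ l m → (∀ P → L l P ≡ L m P) → l ≡ m
    joinUnique : ∀ P Q → P ≢ Q →
                 Σ (Fin 7) λ l → (L l P ≡ true × L l Q ≡ true) ×
                   (∀ m → L m P ≡ true → L m Q ≡ true → m ≡ l)
    meetUnique : ∀ l m → l ≢ m →
                 Σ Pt λ P → (L l P ≡ true × L m P ≡ true) ×
                   (∀ Q → L l Q ≡ true → L m Q ≡ true → Q ≡ P)

-- Fano cube V_F = F ∪ {0}; 0 is nothing.

V : Set
V = Maybe Pt

vecs : List V
vecs = nothing ∷ map just points

eqF : Pt → Pt → Bool
eqF P Q = does (P ≟F Q)

eqV : V → V → Bool
eqV nothing  nothing  = true
eqV nothing  (just _) = false
eqV (just _) nothing  = false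
eqV (just P) (just Q) = eqF P Q

find : ∀ {n} → (Fin n → Bool) → Maybe (Fin n)
find {ℕ.zero}  f = nothing
find {ℕ.suc n} f = if f zero then just zero else Data.Maybe.map suc (find (λ i → f (suc i)))

-- third point of the line through P and Q (P ≠ Q); the default value
-- P is never used when L is a Fano plane
third : Lines → Pt → Pt → Pt
third L P Q =
  maybe′ (λ l → maybe′ (λ R → R) P
                  (find (λ R → L l R ∧ not (eqF R P) ∧ not (eqF R Q))))
         P
         (find (λ l → L l P ∧ L l Q))

add : Lines → V → V → V
add L nothing  y        = y
add L (just P) nothing  = just P
add L (just P) (just Q) = if eqF P Q then nothing else just (third L P Q)

-- Oriented maps  α : F → V_F^*,  with Z₂ = Bool (true = 1, xor = +).
-- An element of V_F^* is a Z₂-linear (i.e. additive) map V_F → Z₂.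

IsLinearFunctional : Lines → (V → Bool) → Set
IsLinearFunctional L f = ∀ x y → f (add L x y) ≡ (f x xor f y)

record IsOrientedMap (L : Lines) (α : Pt → V → Bool) : Set where
  field
    linear : ∀ P → IsLinearFunctional L (α P)
    self   : ∀ P → α P (just P) ≡ true
    anti   : ∀ P Q → P ≢ Q → (α P (just Q) xor α Q (just P)) ≡ true

-- Multiplication factors ε : F × F → {-1,1}  (only values at P ≠ Q matter)

IsMultFactor : (Pt → Pt → Sign) → Set
IsMultFactor ε = ∀ P Q → P ≢ Q → ε Q P ≡ opposite (ε P Q)

eα : (Pt → V → Bool) → Pt → Pt → Sign
eα α P Q = if α P (just Q) then Sign.- else Sign.+

neg-eα : (Pt → V → Bool) → Pt → Pt → Sign
neg-eα α P Q = opposite (eα α P Q)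

future : (Pt → Pt → Sign) → Pt → Pt → Set
future ε P Q = Q ≢ P × ε P Q ≡ Sign.+

past : (Pt → Pt → Sign) → Pt → Pt → Set
past ε P Q = Q ≢ P × ε P Q ≡ Sign.-

IsLine : Lines → (Pt → Set) → Set
IsLine L S = Σ (Fin 7) λ l → ∀ Q → (L l Q ≡ true → S Q) × (S Q → L l Q ≡ true)

record IsField {c ℓ} (R : CommutativeRing c ℓ) : Set (c ⊔ ℓ) where
  open CommutativeRing R
  field
    nontrivial : ¬ (1# ≈ 0#)
    inverse    : ∀ x → ¬ (x ≈ 0#) → Σ Carrier λ y → x * y ≈ 1#

CharNot2 : ∀ {c ℓ} → CommutativeRing c ℓ → Set ℓ
CharNot2 R = ¬ (1# + 1# ≈ 0#) where open CommutativeRing R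

-- The algebra O_F = functions V_F → F, with basis e_X = indicator of X.

module Octonions {c ℓ} (R : CommutativeRing c ℓ) where
  open CommutativeRing R

  O : Set c
  O = V → Carrier

  ∑ : (V → Carrier) → Carrier
  ∑ f = foldr (λ x acc → f x + acc) 0# vecs

  sgn : Sign → Carrier
  sgn Sign.+ = 1#
  sgn Sign.- = - 1#

  -- e_X ·_ε e_Y = coef ε X Y e_{X+Y}
  coef : (Pt → Pt → Sign) → V → V → Carrier
  coef ε nothing  y        = 1#
  coef ε (just P) nothing  = 1#
  coef ε (just P) (just Q) = if eqF P Q then - 1# else sgn (ε P Q)

  mul : Lines → (Pt → Pt → Sign) → O → O → O
  mul L ε Z W T = ∑ λ X → ∑ λ Y →
    if eqV (add L X Y) T then coef ε X Y * (Z X * W Y) else 0#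

  -- the quadratic form 1 : N(Z) = Σ_X Z(X)²
  N : O → Carrier
  N Z = ∑ λ X → Z X * Z X

  IsComposition : Lines → (Pt → Pt → Sign) → Set (c ⊔ ℓ)
  IsComposition L ε = ∀ Z W → N (mul L ε Z W) ≈ N Z * N W

  InPlus₁ : Lines → (Pt → Pt → Sign) → Set (c ⊔ ℓ)
  InPlus₁ L ε = IsMultFactor ε × IsComposition L ε × (∀ P → IsLine L (future ε P))

  InMinus₁ : Lines → (Pt → Pt → Sign) → Set (c ⊔ ℓ)
  InMinus₁ L ε = IsMultFactor ε × IsComposition L ε × (∀ P → IsLine L (past ε P))

-- Linearity of the functionals α_P, together with the orientation axioms (which make them
-- separate points), turns V_F into an elementary abelian 2-group, and e^α_{XY} = (−1)^{β(X,Y)}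
-- for the form β(P, ·) = α_P, β(0, ·) = 0, linear in its second argument. For X ≠ Y the
-- orientation axioms give β(X,X) + β(Y,Y) + β(X,Y) + β(Y,X) = 1, so when
-- N(Z · W) = Σ_T (Σ_X e_{X,X+T} Z_X W_{X+T})² is expanded, the (T, X, Y) and (T + X + Y, X, Y)
-- cross terms cancel and twice N(Z · W) equals twice N(Z) N(W); 2 is invertible. The product
-- for −e^α is the opposite of the product for e^α. Finally α_P is a nonzero functional on the
-- 3-dimensional space V_F, so its kernel is a plane, i.e. a line of F together with 0: it
-- contains the line through any two of its points, and it has no fourth point, since four
-- kernel points and their translates by P would be eight points of F. That line is the future
-- of P for e^α and the past of P for −e^α.

{-# OPTIONS --safe #-}
module Submission where

open import Defs
open import Algebra.Bundles using (CommutativeRing)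
open import Data.Bool using (Bool; true; false; not; _∧_; _xor_; if_then_else_)
open import Data.Product using (_×_; Σ; _,_; proj₁; proj₂)

open import Algebra.Definitions using (Associative; Commutative)
open import Algebra.Structures using (IsAbelianGroup)
import Algebra.Properties.CommutativeSemigroup as CommutativeSemigroupProperties
import Algebra.Properties.Semiring.Sum as SemiringSum
import Algebra.Properties.Ring as RingProperties
import Algebra.Solver.Ring.NaturalCoefficients.Default as NaturalSolver
open import Data.Bool.Properties
  using (∧-assoc; xor-assoc; xor-comm; xor-same; not-distribˡ-xor; not-injective; xor-∧-commutativeRing)
open import Data.Empty using (⊥; ⊥-elim)
open import Data.Fin using (Fin; zero; suc; punchIn)
open import Data.Fin.Permutation using (permutation)
open import Data.Fin.Properties using (punchInᵢ≢i) renaming (_≟_ to _≟F_)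
open import Data.List using (List; []; _∷_; length; filterᵇ)
open import Data.List.Membership.Propositional using (_∈_)
open import Data.List.Membership.Propositional.Properties using (∈-allFin)
open import Data.List.Relation.Unary.All as All using (All; []; _∷_)
open import Data.List.Relation.Unary.Any using (here; there)
open import Data.List.Relation.Unary.Unique.Propositional using (Unique; []; _∷_)
open import Data.List.Relation.Unary.Unique.Propositional.Properties using (allFin⁺)
open import Data.Maybe using (nothing; just)
open import Data.Maybe.Properties using (just-injective)
open import Data.Nat using (ℕ; suc; _≤_; z≤n; s≤s)
import Data.Nat as Nat
open import Data.Nat.Properties
  using (+-suc; +-cancelˡ-≡; +-mono-≤; ≤-trans; ≤-reflexive; <-irrefl; suc-injective; 1+n≢0)
open import Data.Sign using (Sign; opposite)
open import Data.Sign.Properties using (opposite-selfInverse)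
open import Data.Sum using (_⊎_; inj₁; inj₂)
open import Function using (id; _∘_)
open import Level using (_⊔_)
open import Relation.Binary.PropositionalEquality
  using (_≡_; _≢_; refl; sym; trans; cong; cong₂; subst; ≢-sym; module ≡-Reasoning)
open import Relation.Binary.PropositionalEquality.Algebra using (isMagma)
open import Relation.Nullary using (¬_; yes; no)
open import Relation.Nullary.Decidable using (dec-true; dec-false)

eqF-refl : ∀ P → eqF P P ≡ true
eqF-refl P = dec-true (P ≟F P) refl

eqF-false : ∀ {P Q} → P ≢ Q → eqF P Q ≡ false
eqF-false {P} {Q} = dec-false (P ≟F Q)

apart-≢ : ∀ P Q → not (eqF P Q) ≡ true → P ≢ Q
apart-≢ P _ h refl with () ← trans (sym h) (cong not (eqF-refl P))

eqV-refl : ∀ X → eqV X X ≡ true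
eqV-refl nothing  = refl
eqV-refl (just P) = eqF-refl P

eqV-false : ∀ {X Y} → X ≢ Y → eqV X Y ≡ false
eqV-false {nothing} {nothing} X≢Y = ⊥-elim (X≢Y refl)
eqV-false {nothing} {just _}  _   = refl
eqV-false {just _}  {nothing} _   = refl
eqV-false {just _}  {just _}  X≢Y = eqF-false (X≢Y ∘ cong just)

∧-true : ∀ {a b} → a ∧ b ≡ true → a ≡ true × b ≡ true
∧-true {true}  h = refl , h
∧-true {false} ()

apart : ∀ a {R p q} → a ∧ not (eqF R p) ∧ not (eqF R q) ≡ true → a ≡ true × R ≢ p × R ≢ q
apart true  {R} {p} {q} h =
  refl , apart-≢ R p (proj₁ (∧-true {not (eqF R p)} h)) , apart-≢ R q (proj₂ (∧-true {not (eqF R p)} h))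
apart false ()

xor≡true : ∀ {a b} → a xor b ≡ true → b ≡ not a
xor≡true {false}         h = h
xor≡true {true}  {false} _ = refl
xor≡true {true}  {true}  ()

xor-interchange : ∀ a b c d → (a xor b) xor (c xor d) ≡ (a xor c) xor (b xor d)
xor-interchange = CommutativeSemigroupProperties.interchange
  (CommutativeRing.+-commutativeSemigroup xor-∧-commutativeRing)

-- chosen so that eα α P Q reduces to signᵇ (α P (just Q))
signᵇ : Bool → Sign
signᵇ b = if b then Sign.- else Sign.+

signᵇ-not : ∀ b → signᵇ (not b) ≡ opposite (signᵇ b)
signᵇ-not false = refl
signᵇ-not true  = refl

signᵇ≡+ : ∀ {b} → signᵇ b ≡ Sign.+ → b ≡ false
signᵇ≡+ {false} _ = refl
signᵇ≡+ {true}  ()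

find-just : ∀ {n} (f : Fin n → Bool) {i} → find f ≡ just i → f i ≡ true
find-just {suc n} f e with f zero in f0 | find (λ j → f (suc j)) in e′
find-just {suc n} f refl | true  | _      = f0
find-just {suc n} f refl | false | just j = find-just (λ j → f (suc j)) e′

find-nothing : ∀ {n} (f : Fin n → Bool) → find f ≡ nothing → ∀ i → f i ≡ false
find-nothing {suc n} f e i with f zero in f0 | find (λ j → f (suc j)) in e′
find-nothing {suc n} f e zero    | false | nothing = f0
find-nothing {suc n} f e (suc i) | false | nothing = find-nothing (λ j → f (suc j)) e′ i

count : {A : Set} → (A → Bool) → List A → ℕ
count s xs = length (filterᵇ s xs)

count-complement : ∀ {A : Set} (s : A → Bool) xs →
  count s xs Nat.+ count (λ x → not (s x)) xs ≡ length xs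
count-complement s []       = refl
count-complement s (x ∷ xs) with s x
... | true  = cong suc (count-complement s xs)
... | false = trans (+-suc _ _) (cong suc (count-complement s xs))

count-witness : ∀ {A : Set} (s : A → Bool) xs → count s xs ≢ 0 → Σ A λ x → s x ≡ true
count-witness s []       c≢0 = ⊥-elim (c≢0 refl)
count-witness s (x ∷ xs) c≢0 with s x in sx
... | true  = x , sx
... | false = count-witness s xs c≢0

_∖_ : (Pt → Bool) → Pt → Pt → Bool
(s ∖ a) x = s x ∧ not (eqF x a)

∖-keeps : ∀ s {a x} → s x ≡ true → x ≢ a → (s ∖ a) x ≡ true
∖-keeps s sx x≢a rewrite sx | eqF-false x≢a = refl

count-∖-fresh : ∀ s {a xs} → All (a ≢_) xs → count (s ∖ a) xs ≡ count s xs
count-∖-fresh s []                         = refl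
count-∖-fresh s {xs = x ∷ _} (a≢x ∷ fresh) rewrite eqF-false (≢-sym a≢x) with s x
... | true  = cong suc (count-∖-fresh s fresh)
... | false = count-∖-fresh s fresh

count-remove : ∀ s {a xs} → Unique xs → a ∈ xs → s a ≡ true →
  count s xs ≡ suc (count (s ∖ a) xs)
count-remove s {a} (fresh ∷ _) (here refl) sa rewrite sa | eqF-refl a =
  cong suc (sym (count-∖-fresh s fresh))
count-remove s {xs = x ∷ _} (x-fresh ∷ u) (there a∈) sa
  rewrite eqF-false (All.lookup x-fresh a∈) with s x
... | true  = cong suc (count-remove s u a∈ sa)
... | false = count-remove s u a∈ sa

card-remove : ∀ s {a} → s a ≡ true → card s ≡ suc (card (s ∖ a))
card-remove s {a} = count-remove s (allFin⁺ 7) (∈-allFin a)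

card-≥ : ∀ {s ys} → Unique ys → All (λ y → s y ≡ true) ys → length ys ≤ card s
card-≥             []            []          = z≤n
card-≥ {s} {y ∷ _} (fresh ∷ u)   (sy ∷ sys) rewrite card-remove s sy =
  s≤s (card-≥ u (All.zipWith (λ (y≢z , sz) → ∖-keeps s sz (≢-sym y≢z)) (fresh , sys)))

one-of-three : ∀ {a b c d : Pt} → Unique (a ∷ b ∷ c ∷ []) → ¬ Unique (a ∷ b ∷ c ∷ d ∷ []) →
  d ≡ a ⊎ d ≡ b ⊎ d ≡ c
one-of-three {a} {b} {c} {d} ((a≢b ∷ a≢c ∷ []) ∷ (b≢c ∷ []) ∷ [] ∷ []) not-four
  with d ≟F a | d ≟F b | d ≟F c
... | yes d≡a | _       | _       = inj₁ d≡a
... | no _    | yes d≡b | _       = inj₂ (inj₁ d≡b)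
... | no _    | no _    | yes d≡c = inj₂ (inj₂ d≡c)
... | no d≢a  | no d≢b  | no d≢c  = ⊥-elim (not-four
  ((a≢b ∷ a≢c ∷ ≢-sym d≢a ∷ []) ∷ (b≢c ∷ ≢-sym d≢b ∷ []) ∷ (≢-sym d≢c ∷ []) ∷ [] ∷ []))

module FanoPlane {L : Lines} (F : IsFanoPlane L) where
  open IsFanoPlane F

  join : ∀ {p q} → p ≢ q → Fin 7
  join p≢q = proj₁ (joinUnique _ _ p≢q)

  join-∋ˡ : ∀ {p q} (p≢q : p ≢ q) → L (join p≢q) p ≡ true
  join-∋ˡ p≢q = proj₁ (proj₁ (proj₂ (joinUnique _ _ p≢q)))

  join-∋ʳ : ∀ {p q} (p≢q : p ≢ q) → L (join p≢q) q ≡ true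
  join-∋ʳ p≢q = proj₂ (proj₁ (proj₂ (joinUnique _ _ p≢q)))

  join-unique : ∀ {p q} (p≢q : p ≢ q) m → L m p ≡ true → L m q ≡ true → m ≡ join p≢q
  join-unique p≢q = proj₂ (proj₂ (joinUnique _ _ p≢q))

  join-has-third : ∀ {p q} (p≢q : p ≢ q) →
    Σ Pt λ R → L (join p≢q) R ∧ not (eqF R p) ∧ not (eqF R q) ≡ true
  join-has-third {p} {q} p≢q = R , trans (sym (∧-assoc (L l R) _ _)) R-apart
    where
    l = join p≢q
    one-left : card ((L l ∖ p) ∖ q) ≡ 1
    one-left = suc-injective (suc-injective (begin
      suc (suc (card ((L l ∖ p) ∖ q)))
        ≡⟨ cong suc (card-remove (L l ∖ p) (∖-keeps (L l) (join-∋ʳ p≢q) (≢-sym p≢q))) ⟨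
      suc (card (L l ∖ p))  ≡⟨ card-remove (L l) (join-∋ˡ p≢q) ⟨
      card (L l)            ≡⟨ three l ⟩
      3                     ∎))
      where open ≡-Reasoning
    R-witness = count-witness ((L l ∖ p) ∖ q) points λ e → 1+n≢0 (trans (sym one-left) e)
    R = proj₁ R-witness
    R-apart = proj₂ R-witness

  third-spec : ∀ {p q} (p≢q : p ≢ q) →
    L (join p≢q) (third L p q) ≡ true × third L p q ≢ p × third L p q ≢ q
  third-spec {p} {q} p≢q with find (λ m → L m p ∧ L m q) in e₁
  ... | nothing
    with () ← trans (sym (find-nothing (λ m → L m p ∧ L m q) e₁ (join p≢q)))
                    (cong₂ _∧_ (join-∋ˡ p≢q) (join-∋ʳ p≢q))
  ... | just m
    with refl ← join-unique p≢q m (proj₁ (∧-true (find-just (λ m → L m p ∧ L m q) e₁)))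
                                  (proj₂ (∧-true (find-just (λ m → L m p ∧ L m q) e₁)))
    with find (λ R → L (join p≢q) R ∧ not (eqF R p) ∧ not (eqF R q)) in e₂
  ...   | just R =
    apart (L (join p≢q) R) (find-just (λ R → L (join p≢q) R ∧ not (eqF R p) ∧ not (eqF R q)) e₂)
  ...   | nothing
    with () ← trans (sym (find-nothing (λ R → L (join p≢q) R ∧ not (eqF R p) ∧ not (eqF R q)) e₂
                                       (proj₁ (join-has-third p≢q))))
                    (proj₂ (join-has-third p≢q))

  third-∈-join : ∀ {p q} (p≢q : p ≢ q) → L (join p≢q) (third L p q) ≡ true
  third-∈-join p≢q = proj₁ (third-spec p≢q)

  third≢ˡ : ∀ {p q} (p≢q : p ≢ q) → third L p q ≢ p
  third≢ˡ p≢q = proj₁ (proj₂ (third-spec p≢q))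

  third≢ʳ : ∀ {p q} (p≢q : p ≢ q) → third L p q ≢ q
  third≢ʳ p≢q = proj₂ (proj₂ (third-spec p≢q))

  third-distinct : ∀ {p q} (p≢q : p ≢ q) → Unique (p ∷ q ∷ third L p q ∷ [])
  third-distinct p≢q =
    (p≢q ∷ ≢-sym (third≢ˡ p≢q) ∷ []) ∷ (≢-sym (third≢ʳ p≢q) ∷ []) ∷ [] ∷ []

  join-points : ∀ {p q Q} (p≢q : p ≢ q) → L (join p≢q) Q ≡ true →
    Q ≡ p ⊎ Q ≡ q ⊎ Q ≡ third L p q
  join-points p≢q Q∈ = one-of-three (third-distinct p≢q) λ u →
    <-irrefl refl (subst (4 ≤_) (three _)
      (card-≥ u (join-∋ˡ p≢q ∷ join-∋ʳ p≢q ∷ third-∈-join p≢q ∷ Q∈ ∷ [])))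

  ∈-join : ∀ {p q Q} (p≢q : p ≢ q) → Q ≡ p ⊎ Q ≡ q ⊎ Q ≡ third L p q →
    L (join p≢q) Q ≡ true
  ∈-join p≢q (inj₁ refl)        = join-∋ˡ p≢q
  ∈-join p≢q (inj₂ (inj₁ refl)) = join-∋ʳ p≢q
  ∈-join p≢q (inj₂ (inj₂ refl)) = third-∈-join p≢q

  off-line : ∀ m → Σ Pt λ Q → L m Q ≡ false
  off-line m = Q , not-injective notLQ
    where
    four-off : card (λ Q → not (L m Q)) ≡ 4
    four-off = +-cancelˡ-≡ 3 _ _
      (trans (cong (Nat._+ card (λ Q → not (L m Q))) (sym (three m))) (count-complement (L m) points))
    witness = count-witness (λ Q → not (L m Q)) points λ e → 1+n≢0 (trans (sym four-off) e)
    Q = proj₁ witness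
    notLQ = proj₂ witness

⊞-just : ∀ L {p q} → p ≢ q → add L (just p) (just q) ≡ just (third L p q)
⊞-just L p≢q rewrite eqF-false p≢q = refl

module OrientedMap {L : Lines} {α : Pt → V → Bool} (o : IsOrientedMap L α) where
  open IsOrientedMap o
  open ≡-Reasoning

  infixl 6 _⊞_
  _⊞_ : V → V → V
  _⊞_ = add L

  α-nothing : ∀ P → α P nothing ≡ false
  α-nothing P = trans (linear P nothing nothing) (xor-same (α P nothing))

  α-third : ∀ X {p q} → p ≢ q → α X (just (third L p q)) ≡ α X (just p) xor α X (just q)
  α-third X p≢q = trans (cong (α X) (sym (⊞-just L p≢q))) (linear X _ _)

  α-separates : ∀ {X Y} → (∀ P → α P X ≡ α P Y) → X ≡ Y
  α-separates {nothing} {nothing} _ = refl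
  α-separates {nothing} {just Q}  h with () ← trans (sym (α-nothing Q)) (trans (h Q) (self Q))
  α-separates {just P}  {nothing} h with () ← trans (sym (α-nothing P)) (trans (sym (h P)) (self P))
  α-separates {just P}  {just Q}  h with P ≟F Q
  ... | yes P≡Q = cong just P≡Q
  ... | no P≢Q with () ← trans (sym (anti P Q P≢Q))
                        (cong₂ _xor_ (trans (sym (h P)) (self P)) (trans (h Q) (self Q)))

  ⊞-assoc : Associative _≡_ _⊞_
  ⊞-assoc X Y Z = α-separates λ P → begin
    α P (X ⊞ Y ⊞ Z)                 ≡⟨ linear P (X ⊞ Y) Z ⟩
    α P (X ⊞ Y) xor α P Z           ≡⟨ cong (_xor α P Z) (linear P X Y) ⟩
    (α P X xor α P Y) xor α P Z     ≡⟨ xor-assoc (α P X) _ _ ⟩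
    α P X xor (α P Y xor α P Z)     ≡⟨ cong (α P X xor_) (linear P Y Z) ⟨
    α P X xor α P (Y ⊞ Z)           ≡⟨ linear P X (Y ⊞ Z) ⟨
    α P (X ⊞ (Y ⊞ Z))               ∎

  ⊞-comm : Commutative _≡_ _⊞_
  ⊞-comm X Y = α-separates λ P →
    trans (linear P X Y) (trans (xor-comm (α P X) _) (sym (linear P Y X)))

  ⊞-self : ∀ X → X ⊞ X ≡ nothing
  ⊞-self X = α-separates λ P →
    trans (linear P X X) (trans (xor-same (α P X)) (sym (α-nothing P)))

  ⊞-identityʳ : ∀ X → X ⊞ nothing ≡ X
  ⊞-identityʳ nothing  = refl
  ⊞-identityʳ (just _) = refl

  ⊞-isAbelianGroup : IsAbelianGroup _≡_ _⊞_ nothing id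
  ⊞-isAbelianGroup = record
    { isGroup = record
      { isMonoid = record
        { isSemigroup = record { isMagma = isMagma _⊞_ ; assoc = ⊞-assoc }
        ; identity    = (λ _ → refl) , ⊞-identityʳ
        }
      ; inverse = ⊞-self , ⊞-self
      ; ⁻¹-cong = id
      }
    ; comm = ⊞-comm
    }

  β : V → V → Bool
  β nothing  _ = false
  β (just P)   = α P

  β-linear : ∀ X Y T → β X (Y ⊞ T) ≡ β X Y xor β X T
  β-linear nothing  _ _ = refl
  β-linear (just P) Y T = linear P Y T

  β-diagonal : ∀ {X Y} → X ≢ Y → β X X xor β Y Y ≡ not (β X Y xor β Y X)
  β-diagonal {nothing} {nothing} X≢Y = ⊥-elim (X≢Y refl)
  β-diagonal {nothing} {just Q}  _   rewrite self Q | α-nothing Q = refl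
  β-diagonal {just P}  {nothing} _   rewrite self P | α-nothing P = refl
  β-diagonal {just P}  {just Q}  X≢Y rewrite self P | self Q | anti P Q (X≢Y ∘ cong just) = refl

  β-cross : ∀ {X Y} T → X ≢ Y →
    β X (X ⊞ T) xor β Y (Y ⊞ T) ≡ not (β X (Y ⊞ T) xor β Y (X ⊞ T))
  β-cross {X} {Y} T X≢Y = begin
    β X (X ⊞ T) xor β Y (Y ⊞ T)                    ≡⟨ cong₂ _xor_ (β-linear X X T) (β-linear Y Y T) ⟩
    (β X X xor β X T) xor (β Y Y xor β Y T)        ≡⟨ xor-interchange (β X X) _ _ _ ⟩
    (β X X xor β Y Y) xor (β X T xor β Y T)        ≡⟨ cong (_xor (β X T xor β Y T)) (β-diagonal X≢Y) ⟩
    not (β X Y xor β Y X) xor (β X T xor β Y T)    ≡⟨ not-distribˡ-xor (β X Y xor β Y X) _ ⟨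
    not ((β X Y xor β Y X) xor (β X T xor β Y T))  ≡⟨ cong not (xor-interchange (β X Y) _ _ _) ⟩
    not ((β X Y xor β X T) xor (β Y X xor β Y T))  ≡⟨ cong not (cong₂ _xor_ (β-linear X Y T) (β-linear Y X T)) ⟨
    not (β X (Y ⊞ T) xor β Y (X ⊞ T))              ∎

  eα-isMultFactor : IsMultFactor (eα α)
  eα-isMultFactor P Q P≢Q = trans (cong signᵇ (xor≡true (anti P Q P≢Q))) (signᵇ-not _)

  neg-eα-isMultFactor : IsMultFactor (neg-eα α)
  neg-eα-isMultFactor P Q P≢Q = cong opposite (eα-isMultFactor P Q P≢Q)

module ExponentTwo {L : Lines} (G : IsAbelianGroup _≡_ (add L) nothing id) where
  open IsAbelianGroup G using (assoc; comm; inverseʳ; identityʳ)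
  open ≡-Reasoning

  infixl 6 _⊞_
  _⊞_ : V → V → V
  _⊞_ = add L

  ⊞-cancelˡ : ∀ X Y → X ⊞ (X ⊞ Y) ≡ Y
  ⊞-cancelˡ X Y = trans (sym (assoc X X Y)) (cong (_⊞ Y) (inverseʳ X))

  ⊞-cancelʳ : ∀ X Y → X ⊞ Y ⊞ Y ≡ X
  ⊞-cancelʳ X Y = trans (assoc X Y Y) (trans (cong (X ⊞_) (inverseʳ Y)) (identityʳ X))

  ⊞-absorbs : ∀ T X → T ⊞ (X ⊞ X) ≡ T
  ⊞-absorbs T X = trans (cong (T ⊞_) (inverseʳ X)) (identityʳ T)

  ⊞-exchangeˡ : ∀ X Y T → X ⊞ (T ⊞ (X ⊞ Y)) ≡ Y ⊞ T
  ⊞-exchangeˡ X Y T = begin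
    X ⊞ (T ⊞ (X ⊞ Y))  ≡⟨ cong (X ⊞_) (comm T (X ⊞ Y)) ⟩
    X ⊞ (X ⊞ Y ⊞ T)    ≡⟨ cong (X ⊞_) (assoc X Y T) ⟩
    X ⊞ (X ⊞ (Y ⊞ T))  ≡⟨ ⊞-cancelˡ X (Y ⊞ T) ⟩
    Y ⊞ T              ∎

  ⊞-exchangeʳ : ∀ X Y T → Y ⊞ (T ⊞ (X ⊞ Y)) ≡ X ⊞ T
  ⊞-exchangeʳ X Y T = trans (cong (λ U → Y ⊞ (T ⊞ U)) (comm X Y)) (⊞-exchangeˡ Y X T)

module Kernel {L : Lines} (F : IsFanoPlane L) {α : Pt → V → Bool} (o : IsOrientedMap L α) (P : Pt) where
  open IsOrientedMap o
  open FanoPlane F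
  open OrientedMap o using (α-third)
  open ExponentTwo (OrientedMap.⊞-isAbelianGroup o) using (_⊞_; ⊞-cancelˡ)

  InKernel : Pt → Set
  InKernel Q = α P (just Q) ≡ false

  τ : Pt → Pt
  τ = third L P

  kernel-≢ : ∀ {Q} → InKernel Q → Q ≢ P
  kernel-≢ {Q} kQ refl with () ← trans (sym (self Q)) kQ

  τ-flips : ∀ {Q} → Q ≢ P → α P (just (τ Q)) ≡ not (α P (just Q))
  τ-flips {Q} Q≢P = trans (α-third P (≢-sym Q≢P)) (cong (_xor α P (just Q)) (self P))

  τ-involutive : ∀ {Q} → Q ≢ P → τ (τ Q) ≡ Q
  τ-involutive {Q} Q≢P = just-injective (begin
    just (τ (τ Q))             ≡⟨ ⊞-just L (≢-sym (third≢ˡ (≢-sym Q≢P))) ⟨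
    just P ⊞ just (τ Q)        ≡⟨ cong (just P ⊞_) (⊞-just L (≢-sym Q≢P)) ⟨
    just P ⊞ (just P ⊞ just Q) ≡⟨ ⊞-cancelˡ (just P) (just Q) ⟩
    just Q                     ∎)
    where open ≡-Reasoning

  τ-≢ : ∀ {a b} → a ≢ P → b ≢ P → a ≢ b → τ a ≢ τ b
  τ-≢ a≢P b≢P a≢b τa≡τb =
    a≢b (trans (sym (τ-involutive a≢P)) (trans (cong τ τa≡τb) (τ-involutive b≢P)))

  -- P and the translates τ a, τ b, τ c are four further points, off the kernel: 4 + 4 > 7.
  kernel-has-no-four : ∀ {a b c d} → Unique (a ∷ b ∷ c ∷ d ∷ []) →
    All InKernel (a ∷ b ∷ c ∷ d ∷ []) → ⊥
  kernel-has-no-four {a} {b} {c} u@((a≢b ∷ a≢c ∷ _) ∷ (b≢c ∷ _) ∷ _) ks@(ka ∷ kb ∷ kc ∷ _) =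
    <-irrefl refl (≤-trans (+-mono-≤ outside inside) (≤-reflexive (count-complement αP points)))
    where
    αP = λ Q → α P (just Q)
    a≢P = kernel-≢ ka
    b≢P = kernel-≢ kb
    c≢P = kernel-≢ kc
    inside : 4 ≤ card (λ Q → not (αP Q))
    inside = card-≥ {s = λ Q → not (αP Q)} u (All.map (cong not) ks)
    translates : Unique (P ∷ τ a ∷ τ b ∷ τ c ∷ [])
    translates =
      (≢-sym (third≢ˡ (≢-sym a≢P)) ∷ ≢-sym (third≢ˡ (≢-sym b≢P)) ∷ ≢-sym (third≢ˡ (≢-sym c≢P)) ∷ [])
      ∷ (τ-≢ a≢P b≢P a≢b ∷ τ-≢ a≢P c≢P a≢c ∷ [])
      ∷ (τ-≢ b≢P c≢P b≢c ∷ [])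
      ∷ [] ∷ []
    flipped : ∀ {Q} → InKernel Q → αP (τ Q) ≡ true
    flipped kQ = trans (τ-flips (kernel-≢ kQ)) (cong not kQ)
    outside : 4 ≤ card αP
    outside = card-≥ {s = αP} translates (self P ∷ flipped ka ∷ flipped kb ∷ flipped kc ∷ [])

  kernel-third : ∀ {p q} (p≢q : p ≢ q) → InKernel p → InKernel q → InKernel (third L p q)
  kernel-third p≢q kp kq = trans (α-third P p≢q) (cong₂ _xor_ kp kq)

  kernel-point : ∀ {Q} → Q ≢ P → Σ Pt λ Q′ → InKernel Q′ × (Q′ ≡ Q ⊎ Q′ ≡ τ Q)
  kernel-point {Q} Q≢P with α P (just Q) in αQ
  ... | false = Q , αQ , inj₁ refl
  ... | true  = τ Q , trans (τ-flips Q≢P) (cong not αQ) , inj₂ refl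

  off-join-≢ : ∀ {Q₁ Q′} (P≢Q₁ : P ≢ Q₁) → L (join P≢Q₁) Q′ ≡ false → Q′ ≢ P
  off-join-≢ P≢Q₁ Q′∉ refl with () ← trans (sym (join-∋ˡ P≢Q₁)) Q′∉

  -- Q₂ = τ Q′ = Q₁ would put Q′ = τ Q₁ on the line through P and Q₁.
  second-kernel-point : ∀ {Q₁} → InKernel Q₁ → Σ Pt λ Q₂ → Q₁ ≢ Q₂ × InKernel Q₂
  second-kernel-point {Q₁} k₁ with off-line (join (≢-sym (kernel-≢ k₁)))
  ... | Q′ , Q′∉ with kernel-point (off-join-≢ (≢-sym (kernel-≢ k₁)) Q′∉)
  ...   | Q₂ , k₂ , inj₁ refl = Q₂ , Q₁≢Q′ , k₂
    where
    Q₁≢Q′ : Q₁ ≢ Q′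
    Q₁≢Q′ Q₁≡Q′ with () ← trans (sym (join-∋ʳ _)) (trans (cong (L _) Q₁≡Q′) Q′∉)
  ...   | Q₂ , k₂ , inj₂ refl = Q₂ , Q₁≢τQ′ , k₂
    where
    Q₁≢τQ′ : Q₁ ≢ τ Q′
    Q₁≢τQ′ Q₁≡τQ′ with () ← trans (sym (third-∈-join _))
      (trans (cong (L _ ∘ τ) Q₁≡τQ′) (trans (cong (L _) (τ-involutive (off-join-≢ _ Q′∉))) Q′∉))

  kernel-isLine : Σ (Fin 7) λ l → ∀ Q → (L l Q ≡ true → InKernel Q) × (InKernel Q → L l Q ≡ true)
  kernel-isLine with kernel-point (punchInᵢ≢i P zero)
  ... | Q₁ , k₁ , _ with second-kernel-point k₁
  ...   | Q₂ , Q₁≢Q₂ , k₂ = join Q₁≢Q₂ , λ Q → on-line⇒kernel , kernel⇒on-line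
    where
    kR = kernel-third Q₁≢Q₂ k₁ k₂
    on-line⇒kernel : ∀ {Q} → L (join Q₁≢Q₂) Q ≡ true → InKernel Q
    on-line⇒kernel Q∈ with join-points Q₁≢Q₂ Q∈
    ... | inj₁ refl        = k₁
    ... | inj₂ (inj₁ refl) = k₂
    ... | inj₂ (inj₂ refl) = kR
    kernel⇒on-line : ∀ {Q} → InKernel Q → L (join Q₁≢Q₂) Q ≡ true
    kernel⇒on-line kQ = ∈-join Q₁≢Q₂ (one-of-three (third-distinct Q₁≢Q₂) λ u →
      kernel-has-no-four u (k₁ ∷ k₂ ∷ kR ∷ kQ ∷ []))

  isLine-of-kernel : ∀ {S : Pt → Set} → (∀ Q → S Q → InKernel Q) → (∀ Q → InKernel Q → S Q) → IsLine L S
  isLine-of-kernel S⊆K K⊆S =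
    proj₁ kernel-isLine , λ Q →
      (λ Q∈ → K⊆S Q (proj₁ (proj₂ kernel-isLine Q) Q∈)) , (λ SQ → proj₂ (proj₂ kernel-isLine Q) (S⊆K Q SQ))

  future-isLine : IsLine L (future (eα α) P)
  future-isLine = isLine-of-kernel (λ _ (_ , e) → signᵇ≡+ e) (λ _ kQ → kernel-≢ kQ , cong signᵇ kQ)

  past-isLine : IsLine L (past (neg-eα α) P)
  past-isLine = isLine-of-kernel (λ _ (_ , e) → signᵇ≡+ (sym (opposite-selfInverse e)))
    (λ _ kQ → kernel-≢ kQ , cong (opposite ∘ signᵇ) kQ)

module CompositionAlgebra {c ℓ} (R : CommutativeRing c ℓ) where
  open CommutativeRing R hiding (zero) renaming (refl to ≈-refl; sym to ≈-sym; trans to ≈-trans)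
  open Octonions R
  open SemiringSum semiring using (sum; sum-cong-≋; sum-remove; ∑-distrib-+; ∑-comm; ∑-permute; *-distribˡ-sum; *-distribʳ-sum)
  open RingProperties ring using (-1*x≈-x; -‿involutive)
  open NaturalSolver commutativeSemiring using (solve; _:=_; _:+_; _:*_)
  open import Relation.Binary.Reasoning.Setoid setoid

  -- ∑ f reduces to sum (f ∘ toV), so the sum lemmas for vectors over Fin 8 apply to ∑ directly.
  toV : Fin 8 → V
  toV zero    = nothing
  toV (suc P) = just P

  fromV : V → Fin 8
  fromV nothing  = zero
  fromV (just P) = suc P

  toV-fromV : ∀ X → toV (fromV X) ≡ X
  toV-fromV nothing  = refl
  toV-fromV (just _) = refl

  fromV-toV : ∀ i → fromV (toV i) ≡ i
  fromV-toV zero    = refl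
  fromV-toV (suc _) = refl

  ∑-cong : ∀ {f g : V → Carrier} → (∀ X → f X ≈ g X) → ∑ f ≈ ∑ g
  ∑-cong f≈g = sum-cong-≋ (f≈g ∘ toV)

  ∑-+ : ∀ (f g : V → Carrier) → ∑ (λ X → f X + g X) ≈ ∑ f + ∑ g
  ∑-+ f g = ∑-distrib-+ (f ∘ toV) (g ∘ toV)

  ∑-swap : ∀ (f : V → V → Carrier) → ∑ (λ X → ∑ (f X)) ≈ ∑ (λ Y → ∑ (λ X → f X Y))
  ∑-swap f = ∑-comm (λ i j → f (toV i) (toV j))

  ∑-*ˡ : ∀ x (f : V → Carrier) → x * ∑ f ≈ ∑ (λ X → x * f X)
  ∑-*ˡ x f = *-distribˡ-sum x (f ∘ toV)

  ∑-*ʳ : ∀ x (f : V → Carrier) → ∑ f * x ≈ ∑ (λ X → f X * x)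
  ∑-*ʳ x f = *-distribʳ-sum x (f ∘ toV)

  ∑-*-∑ : ∀ (f g : V → Carrier) → ∑ f * ∑ g ≈ ∑ (λ X → ∑ (λ Y → f X * g Y))
  ∑-*-∑ f g = ≈-trans (∑-*ʳ (∑ g) f) (∑-cong λ X → ∑-*ˡ (f X) g)

  ∑-involution : ∀ (σ : V → V) → (∀ X → σ (σ X) ≡ X) → (f : V → Carrier) → ∑ f ≈ ∑ (f ∘ σ)
  ∑-involution σ σσ f =
    ≈-trans (∑-permute (f ∘ toV) π) (sum-cong-≋ λ i → reflexive (cong f (toV-fromV (σ (toV i)))))
    where
    s : Fin 8 → Fin 8
    s i = fromV (σ (toV i))
    ss : ∀ i → s (s i) ≡ i
    ss i = trans (cong (fromV ∘ σ) (toV-fromV (σ (toV i)))) (trans (cong fromV (σσ (toV i))) (fromV-toV i))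
    π = permutation s s ss ss

  ∑-single : ∀ U {f : V → Carrier} → (∀ X → X ≢ U → f X ≈ 0#) → ∑ f ≈ f U
  ∑-single U {f} f≈0 = begin
    ∑ f                                  ≈⟨ sum-remove {i = fromV U} (f ∘ toV) ⟩
    f (toV (fromV U)) + sum (λ j → f (toV (punchIn (fromV U) j)))
      ≈⟨ +-cong (reflexive (cong f (toV-fromV U))) (sum-cong-≋ λ j → f≈0 _ (off j)) ⟩
    f U + sum (λ (_ : Fin 7) → 0#)       ≈⟨ +-congˡ (zeros 7) ⟩
    f U + 0#                             ≈⟨ +-identityʳ (f U) ⟩
    f U                                  ∎
    where
    off : ∀ j → toV (punchIn (fromV U) j) ≢ U
    off j e = punchInᵢ≢i (fromV U) j (trans (sym (fromV-toV _)) (cong fromV e))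
    zeros : ∀ n → sum (λ (_ : Fin n) → 0#) ≈ 0#
    zeros 0       = ≈-refl
    zeros (suc n) = ≈-trans (+-congˡ (zeros n)) (+-identityʳ 0#)

  sgn²≈1 : ∀ s → sgn s * sgn s ≈ 1#
  sgn²≈1 Sign.+ = *-identityˡ 1#
  sgn²≈1 Sign.- = ≈-trans (-1*x≈-x (- 1#)) (-‿involutive 1#)

  coef²≈1 : ∀ ε X Y → coef ε X Y * coef ε X Y ≈ 1#
  coef²≈1 ε nothing  _        = sgn²≈1 Sign.+
  coef²≈1 ε (just _) nothing  = sgn²≈1 Sign.+
  coef²≈1 ε (just P) (just Q) with eqF P Q
  ... | true  = sgn²≈1 Sign.-
  ... | false = sgn²≈1 (ε P Q)

  sgn-signᵇ-xor : ∀ a b → sgn (signᵇ a) * sgn (signᵇ b) ≈ sgn (signᵇ (a xor b))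
  sgn-signᵇ-xor false b     = *-identityˡ _
  sgn-signᵇ-xor true  false = *-identityʳ _
  sgn-signᵇ-xor true  true  = sgn²≈1 Sign.-

  sgn-signᵇ-not : ∀ a → sgn (signᵇ (not a)) ≈ - sgn (signᵇ a)
  sgn-signᵇ-not false = ≈-refl
  sgn-signᵇ-not true  = ≈-sym (-‿involutive 1#)

  coef-transpose : ∀ {ε ε′} → (∀ P Q → P ≢ Q → ε′ P Q ≡ ε Q P) → ∀ X Y → coef ε′ X Y ≡ coef ε Y X
  coef-transpose h nothing  nothing  = refl
  coef-transpose h nothing  (just _) = refl
  coef-transpose h (just _) nothing  = refl
  coef-transpose h (just P) (just Q) with P ≟F Q
  ... | yes refl rewrite eqF-refl P = refl
  ... | no P≢Q rewrite eqF-false (≢-sym P≢Q) = cong sgn (h P Q P≢Q)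

  TwoInvertible : Set (c ⊔ ℓ)
  TwoInvertible = Σ Carrier λ y → (1# + 1#) * y ≈ 1#

  double-injective : TwoInvertible → ∀ {s m} → s + s ≈ m + m → s ≈ m
  double-injective (y , 2y≈1) {s} {m} s+s≈m+m = begin
    s            ≈⟨ halve s ⟩
    (s + s) * y  ≈⟨ *-congʳ s+s≈m+m ⟩
    (m + m) * y  ≈⟨ halve m ⟨
    m            ∎
    where
    spread : ∀ x e z → x * ((e + e) * z) ≈ (x * e + x * e) * z
    spread = solve 3 (λ x e z → x :* ((e :+ e) :* z) := (x :* e :+ x :* e) :* z) ≈-refl
    halve : ∀ x → x ≈ (x + x) * y
    halve x = begin
      x                          ≈⟨ *-identityʳ x ⟨
      x * 1#                     ≈⟨ *-congˡ 2y≈1 ⟨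
      x * ((1# + 1#) * y)        ≈⟨ spread x 1# y ⟩
      (x * 1# + x * 1#) * y      ≈⟨ *-congʳ (+-cong (*-identityʳ x) (*-identityʳ x)) ⟩
      (x + x) * y                ∎

  paired-products-cancel : ∀ c₁ c₂ c₃ c₄ z z′ w w′ → c₁ * c₂ ≈ - (c₃ * c₄) →
    (c₁ * (z * w)) * (c₂ * (z′ * w′)) + (c₃ * (z * w′)) * (c₄ * (z′ * w)) ≈ 0#
  paired-products-cancel c₁ c₂ c₃ c₄ z z′ w w′ h = begin
    (c₁ * (z * w)) * (c₂ * (z′ * w′)) + (c₃ * (z * w′)) * (c₄ * (z′ * w))
      ≈⟨ +-cong (regroup c₁ c₂ z z′ w w′) (≈-trans (regroup c₃ c₄ z z′ w′ w) (*-congˡ (*-congˡ (*-comm w′ w)))) ⟩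
    (c₁ * c₂) * K + (c₃ * c₄) * K        ≈⟨ distribʳ K _ _ ⟨
    (c₁ * c₂ + c₃ * c₄) * K              ≈⟨ *-congʳ (+-congʳ h) ⟩
    (- (c₃ * c₄) + c₃ * c₄) * K          ≈⟨ *-congʳ (-‿inverseˡ _) ⟩
    0# * K                               ≈⟨ zeroˡ K ⟩
    0#                                   ∎
    where
    K = z * z′ * (w * w′)
    regroup : ∀ a b x x′ y y′ → (a * (x * y)) * (b * (x′ * y′)) ≈ (a * b) * (x * x′ * (y * y′))
    regroup = solve 6 (λ a b x x′ y y′ →
      (a :* (x :* y)) :* (b :* (x′ :* y′)) := (a :* b) :* (x :* x′ :* (y :* y′))) ≈-refl

  module TwistedGroupAlgebra {L : Lines} (G : IsAbelianGroup _≡_ (add L) nothing id) where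
    open ExponentTwo G
    open IsAbelianGroup G using (comm)

    CrossTermsCancel : (Pt → Pt → Sign) → Set ℓ
    CrossTermsCancel ε = ∀ X Y T → X ≢ Y →
      coef ε X (X ⊞ T) * coef ε Y (Y ⊞ T) ≈ - (coef ε X (Y ⊞ T) * coef ε Y (X ⊞ T))

    module _ {ε : Pt → Pt → Sign} (cancels : CrossTermsCancel ε) (Z W : O) where
      term : V → V → Carrier
      term T X = coef ε X (X ⊞ T) * (Z X * W (X ⊞ T))

      mul≈∑term : ∀ T → mul L ε Z W T ≈ ∑ (term T)
      mul≈∑term T = ∑-cong λ X → ≈-trans (∑-single (X ⊞ T) (off X)) (reflexive (on X))
        where
        on : ∀ X → (if eqV (X ⊞ (X ⊞ T)) T then coef ε X (X ⊞ T) * (Z X * W (X ⊞ T)) else 0#) ≡ term T X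
        on X rewrite ⊞-cancelˡ X T | eqV-refl T = refl
        off : ∀ X Y → Y ≢ X ⊞ T → (if eqV (X ⊞ Y) T then coef ε X Y * (Z X * W Y) else 0#) ≈ 0#
        off X Y Y≢X⊞T
          rewrite eqV-false {X ⊞ Y} {T} λ e → Y≢X⊞T (trans (sym (⊞-cancelˡ X Y)) (cong (X ⊞_) e)) = ≈-refl

      cross : V → V → V → Carrier
      cross T X Y = term T X * term T Y

      cross-cancel : ∀ T X Y → X ≢ Y → cross T X Y + cross (T ⊞ (X ⊞ Y)) X Y ≈ 0#
      cross-cancel T X Y X≢Y rewrite ⊞-exchangeˡ X Y T | ⊞-exchangeʳ X Y T =
        paired-products-cancel _ _ _ _ (Z X) (Z Y) (W (X ⊞ T)) (W (Y ⊞ T)) (cancels X Y T X≢Y)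

      paired-sum : ∀ T X → ∑ (λ Y → cross T X Y + cross (T ⊞ (X ⊞ Y)) X Y) ≈ cross T X X + cross T X X
      paired-sum T X = ≈-trans (∑-single X λ Y Y≢X → cross-cancel T X Y (≢-sym Y≢X))
                             (reflexive (cong (λ U → cross T X X + cross U X X) (⊞-absorbs T X)))

      diagonal : ∀ T X → cross T X X ≈ (Z X * Z X) * (W (X ⊞ T) * W (X ⊞ T))
      diagonal T X = begin
        cross T X X                               ≈⟨ square (coef ε X (X ⊞ T)) (Z X) (W (X ⊞ T)) ⟩
        (coef ε X (X ⊞ T) * coef ε X (X ⊞ T)) * ((Z X * Z X) * (W (X ⊞ T) * W (X ⊞ T)))
          ≈⟨ *-congʳ (coef²≈1 ε X (X ⊞ T)) ⟩
        1# * ((Z X * Z X) * (W (X ⊞ T) * W (X ⊞ T))) ≈⟨ *-identityˡ _ ⟩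
        (Z X * Z X) * (W (X ⊞ T) * W (X ⊞ T))     ∎
        where
        square : ∀ e z w → (e * (z * w)) * (e * (z * w)) ≈ (e * e) * ((z * z) * (w * w))
        square = solve 3 (λ e z w → (e :* (z :* w)) :* (e :* (z :* w)) := (e :* e) :* ((z :* z) :* (w :* w))) ≈-refl

      S D : Carrier
      S = ∑ λ T → ∑ λ X → ∑ λ Y → cross T X Y
      D = ∑ λ X → ∑ λ T → cross T X X

      N-mul≈S : N (mul L ε Z W) ≈ S
      N-mul≈S = ∑-cong λ T → ≈-trans (*-cong (mul≈∑term T) (mul≈∑term T)) (∑-*-∑ (term T) (term T))

      S≈∑XY : S ≈ ∑ λ X → ∑ λ Y → ∑ λ T → cross T X Y
      S≈∑XY = ≈-trans (∑-swap λ T X → ∑ (cross T X)) (∑-cong λ X → ∑-swap λ T Y → cross T X Y)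

      S≈∑XY-shifted : S ≈ ∑ λ X → ∑ λ Y → ∑ λ T → cross (T ⊞ (X ⊞ Y)) X Y
      S≈∑XY-shifted = ≈-trans S≈∑XY (∑-cong λ X → ∑-cong λ Y →
        ∑-involution (_⊞ (X ⊞ Y)) (λ T → ⊞-cancelʳ T (X ⊞ Y)) (λ T → cross T X Y))

      S+S≈D+D : S + S ≈ D + D
      S+S≈D+D = begin
        S + S
          ≈⟨ +-cong S≈∑XY S≈∑XY-shifted ⟩
        (∑ λ X → ∑ (pairs₁ X)) + (∑ λ X → ∑ (pairs₂ X))
          ≈⟨ ∑-+ (λ X → ∑ (pairs₁ X)) (λ X → ∑ (pairs₂ X)) ⟨
        (∑ λ X → ∑ (pairs₁ X) + ∑ (pairs₂ X))
          ≈⟨ ∑-cong (λ X → ∑-+ (pairs₁ X) (pairs₂ X)) ⟨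
        (∑ λ X → ∑ λ Y → pairs₁ X Y + pairs₂ X Y)
          ≈⟨ ∑-cong (λ X → ∑-cong λ Y → ∑-+ (λ T → cross T X Y) (λ T → cross (T ⊞ (X ⊞ Y)) X Y)) ⟨
        (∑ λ X → ∑ λ Y → ∑ λ T → cross T X Y + cross (T ⊞ (X ⊞ Y)) X Y)
          ≈⟨ ∑-cong (λ X → ∑-swap λ Y T → cross T X Y + cross (T ⊞ (X ⊞ Y)) X Y) ⟩
        (∑ λ X → ∑ λ T → ∑ λ Y → cross T X Y + cross (T ⊞ (X ⊞ Y)) X Y)
          ≈⟨ ∑-cong (λ X → ∑-cong λ T → paired-sum T X) ⟩
        (∑ λ X → ∑ λ T → cross T X X + cross T X X)
          ≈⟨ ∑-cong (λ X → ∑-+ (λ T → cross T X X) (λ T → cross T X X)) ⟩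
        (∑ λ X → ∑ (λ T → cross T X X) + ∑ (λ T → cross T X X))
          ≈⟨ ∑-+ (λ X → ∑ λ T → cross T X X) (λ X → ∑ λ T → cross T X X) ⟩
        D + D
          ∎
        where
        pairs₁ pairs₂ : V → V → Carrier
        pairs₁ X Y = ∑ λ T → cross T X Y
        pairs₂ X Y = ∑ λ T → cross (T ⊞ (X ⊞ Y)) X Y

      D≈NZ*NW : D ≈ N Z * N W
      D≈NZ*NW = begin
        D  ≈⟨ ∑-cong (λ X → ∑-cong λ T → diagonal T X) ⟩
        (∑ λ X → ∑ λ T → (Z X * Z X) * (W (X ⊞ T) * W (X ⊞ T)))
          ≈⟨ ∑-cong (λ X → ∑-*ˡ (Z X * Z X) (λ T → W (X ⊞ T) * W (X ⊞ T))) ⟨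
        (∑ λ X → (Z X * Z X) * ∑ (λ T → W (X ⊞ T) * W (X ⊞ T)))
          ≈⟨ ∑-cong (λ X → *-congˡ {Z X * Z X} (∑-involution (X ⊞_) (⊞-cancelˡ X) (λ T → W T * W T))) ⟨
        (∑ λ X → (Z X * Z X) * N W)  ≈⟨ ∑-*ʳ (N W) (λ X → Z X * Z X) ⟨
        N Z * N W  ∎

    isComposition : ∀ {ε} → TwoInvertible → CrossTermsCancel ε → IsComposition L ε
    isComposition {ε} two⁻¹ cancels Z W = begin
      N (mul L ε Z W)  ≈⟨ N-mul≈S cancels Z W ⟩
      S cancels Z W    ≈⟨ double-injective two⁻¹ (S+S≈D+D cancels Z W) ⟩
      D cancels Z W    ≈⟨ D≈NZ*NW cancels Z W ⟩
      N Z * N W        ∎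

    mul-transpose : ∀ {ε ε′} → (∀ X Y → coef ε′ X Y ≡ coef ε Y X) →
      ∀ Z W T → mul L ε′ Z W T ≈ mul L ε W Z T
    mul-transpose {ε} {ε′} transposed Z W T = ≈-trans
      (∑-cong {λ X → ∑ λ Y → if eqV (X ⊞ Y) T then coef ε′ X Y * (Z X * W Y) else 0#}
              {λ X → ∑ λ Y → if eqV (Y ⊞ X) T then coef ε Y X * (W Y * Z X) else 0#}
              (λ X → ∑-cong (entry X)))
      (∑-swap λ X Y → if eqV (Y ⊞ X) T then coef ε Y X * (W Y * Z X) else 0#)
      where
      entry : ∀ X Y → (if eqV (X ⊞ Y) T then coef ε′ X Y * (Z X * W Y) else 0#)
                    ≈ (if eqV (Y ⊞ X) T then coef ε Y X * (W Y * Z X) else 0#)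
      entry X Y rewrite comm X Y | transposed X Y with eqV (Y ⊞ X) T
      ... | true  = *-congˡ (*-comm (Z X) (W Y))
      ... | false = ≈-refl

    isComposition-transpose : ∀ {ε ε′} → (∀ X Y → coef ε′ X Y ≡ coef ε Y X) →
      IsComposition L ε → IsComposition L ε′
    isComposition-transpose {ε} {ε′} transposed comp Z W = begin
      N (mul L ε′ Z W)  ≈⟨ ∑-cong {λ T → mul L ε′ Z W T * mul L ε′ Z W T} {λ T → mul L ε W Z T * mul L ε W Z T}
                             (λ T → *-cong (mul-transpose transposed Z W T) (mul-transpose transposed Z W T)) ⟩
      N (mul L ε W Z)   ≈⟨ comp W Z ⟩
      N W * N Z         ≈⟨ *-comm (N W) (N Z) ⟩
      N Z * N W         ∎

  module _ {L : Lines} {α : Pt → V → Bool} (o : IsOrientedMap L α) where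
    open IsOrientedMap o
    open OrientedMap o
    open TwistedGroupAlgebra ⊞-isAbelianGroup

    coef-eα : ∀ X Y → coef (eα α) X Y ≡ sgn (signᵇ (β X Y))
    coef-eα nothing  _        = refl
    coef-eα (just P) nothing  rewrite α-nothing P = refl
    coef-eα (just P) (just Q) with P ≟F Q
    ... | yes refl rewrite self P = refl
    ... | no _     = refl

    eα-crossTermsCancel : CrossTermsCancel (eα α)
    eα-crossTermsCancel X Y T X≢Y = begin
      coef (eα α) X (X ⊞ T) * coef (eα α) Y (Y ⊞ T)
        ≡⟨ cong₂ _*_ (coef-eα X (X ⊞ T)) (coef-eα Y (Y ⊞ T)) ⟩
      sgn (signᵇ (β X (X ⊞ T))) * sgn (signᵇ (β Y (Y ⊞ T)))
        ≈⟨ sgn-signᵇ-xor (β X (X ⊞ T)) (β Y (Y ⊞ T)) ⟩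
      sgn (signᵇ (β X (X ⊞ T) xor β Y (Y ⊞ T)))
        ≡⟨ cong (sgn ∘ signᵇ) (β-cross T X≢Y) ⟩
      sgn (signᵇ (not (β X (Y ⊞ T) xor β Y (X ⊞ T))))
        ≈⟨ sgn-signᵇ-not (β X (Y ⊞ T) xor β Y (X ⊞ T)) ⟩
      - sgn (signᵇ (β X (Y ⊞ T) xor β Y (X ⊞ T)))
        ≈⟨ -‿cong (sgn-signᵇ-xor (β X (Y ⊞ T)) (β Y (X ⊞ T))) ⟨
      - (sgn (signᵇ (β X (Y ⊞ T))) * sgn (signᵇ (β Y (X ⊞ T))))
        ≡⟨ cong -_ (cong₂ _*_ (coef-eα X (Y ⊞ T)) (coef-eα Y (X ⊞ T))) ⟨
      - (coef (eα α) X (Y ⊞ T) * coef (eα α) Y (X ⊞ T))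
        ∎

    eα-isComposition : TwoInvertible → IsComposition L (eα α)
    eα-isComposition two⁻¹ = isComposition two⁻¹ eα-crossTermsCancel

    neg-eα-isComposition : TwoInvertible → IsComposition L (neg-eα α)
    neg-eα-isComposition two⁻¹ = isComposition-transpose
      (coef-transpose λ P Q P≢Q → sym (eα-isMultFactor P Q P≢Q)) (eα-isComposition two⁻¹)

proposition4p2 : ∀ {c ℓ} (R : CommutativeRing c ℓ) → IsField R → CharNot2 R →
    (L : Lines) → IsFanoPlane L →
    (α : Pt → V → Bool) → IsOrientedMap L α →
    Octonions.InPlus₁ R L (eα α) × Octonions.InMinus₁ R L (neg-eα α)
proposition4p2 R isField char≢2 L F α o =
    (eα-isMultFactor , eα-isComposition o two⁻¹ , λ P → Kernel.future-isLine F o P)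
  , (neg-eα-isMultFactor , neg-eα-isComposition o two⁻¹ , λ P → Kernel.past-isLine F o P)
  where
  open CommutativeRing R using (1#; _+_)
  open OrientedMap o using (eα-isMultFactor; neg-eα-isMultFactor)
  open CompositionAlgebra R using (eα-isComposition; neg-eα-isComposition)
  two⁻¹ = IsField.inverse isField (1# + 1#) char≢2
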